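{- Let $N$ be a positive integer and let $M$ be a model of the $L_N$-theory $\mathcal{T}_N$ (with $L_N=\{f\}$, $f$ unary), which states that $f$ is injective, that $M\setminus f(M)$ has exactly $N$ elements, and that $f^n(x)\neq x$ for all $x$ and all integers $n\geq 1$. Then for every $k\in\mathbb{N}$, there exists a definable bijection from $M$ onto $M$ deprived of $k$ points if and only if $N$ divides $k$. In particular, if $N\geq 2$, then for every $x\in M$ there exist definable injections $M\to M\setminus\{x\}$ and $M\setminus\{x\}\to M$, but there is no definable bijection between $M$ and $M\setminus\{x\}$.
   Context: Definable means definable with parameters from $M$ in the language $\{f\}$. $f^n$ denotes the $n$-th iterate of $f$. -}

module Defs where

open import Data.Nat using (ℕ; zero; suc; _+_; _≥_)
open import Data.Fin using (Fin; zero; suc)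
open import Data.Vec.Functional using (Vector; _∷_; _++_; [])
open import Data.Product using (Σ; _×_; _,_; ∃)
open import Data.Sum using (_⊎_)
open import Data.Empty using (⊥)
open import Data.Unit using (⊤)
open import Relation.Nullary using (¬_; Dec)
open import Relation.Binary.PropositionalEquality using (_≡_; _≢_)

-- First-order syntax of the language L = {f}, f unary (de Bruijn style:
-- a term/formula of type n has free variables among Fin n).

data Term (n : ℕ) : Set where
  var : Fin n → Term n
  app : Term n → Term n

data Formula : ℕ → Set where
  _≐_  : ∀ {n} → Term n → Term n → Formula n
  ⊤'   : ∀ {n} → Formula n
  ⊥'   : ∀ {n} → Formula n
  ¬'_  : ∀ {n} → Formula n → Formula n
  _∧'_ : ∀ {n} → Formula n → Formula n → Formula n
  _∨'_ : ∀ {n} → Formula n → Formula n → Formula n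
  _⇒'_ : ∀ {n} → Formula n → Formula n → Formula n
  ∃'   : ∀ {n} → Formula (suc n) → Formula n
  ∀'   : ∀ {n} → Formula (suc n) → Formula n

record Structure : Set₁ where
  field
    Carrier : Set
    f       : Carrier → Carrier

module _ (𝑀 : Structure) where
  open Structure 𝑀 renaming (Carrier to M)

  evalT : ∀ {n} → Term n → Vector M n → M
  evalT (var i) ρ = ρ i
  evalT (app t) ρ = f (evalT t ρ)

  Sat : ∀ {n} → Formula n → Vector M n → Set
  Sat (s ≐ t)   ρ = evalT s ρ ≡ evalT t ρ
  Sat ⊤'        ρ = ⊤
  Sat ⊥'        ρ = ⊥
  Sat (¬' φ)    ρ = ¬ Sat φ ρ
  Sat (φ ∧' ψ)  ρ = Sat φ ρ × Sat ψ ρ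
  Sat (φ ∨' ψ)  ρ = Sat φ ρ ⊎ Sat ψ ρ
  Sat (φ ⇒' ψ)  ρ = Sat φ ρ → Sat ψ ρ
  Sat (∃' φ)    ρ = Σ M λ a → Sat φ (a ∷ ρ)
  Sat (∀' φ)    ρ = (a : M) → Sat φ (a ∷ ρ)

  Definable : (n : ℕ) → (Vector M n → Set) → Set
  Definable n P = Σ ℕ λ m → Σ (Formula (n + m)) λ φ → Σ (Vector M m) λ b →
    (a : Vector M n) → (P a → Sat φ (a ++ b)) × (Sat φ (a ++ b) → P a)

  DefinableSet : (M → Set) → Set
  DefinableSet A = Definable 1 (λ v → A (v zero))

  record DefMap (A B : M → Set) : Set₁ where
    field
      Graph      : M → M → Set
      definable  : Definable 2 (λ v → Graph (v zero) (v (suc zero)))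
      graph⊆     : ∀ {a b} → Graph a b → A a × B b
      total      : ∀ {a} → A a → Σ M λ b → Graph a b
      functional : ∀ {a b b'} → Graph a b → Graph a b' → b ≡ b'

  DefInjection : (A B : M → Set) → Set₁
  DefInjection A B = Σ (DefMap A B) λ h →
    ∀ {a a' b} → DefMap.Graph h a b → DefMap.Graph h a' b → a ≡ a'

  DefBijection : (A B : M → Set) → Set₁
  DefBijection A B = Σ (DefInjection A B) λ h →
    ∀ {b} → B b → Σ M λ a → DefMap.Graph (Data.Product.proj₁ h) a b

  Whole : M → Set
  Whole _ = ⊤

  Deprived : ∀ {k} → Vector M k → M → Set
  Deprived {k} a x = (i : Fin k) → x ≢ a i

  iter : ℕ → M → M
  iter zero    x = x
  iter (suc n) x = f (iter n x)

  record IsModelT (N : ℕ) : Set where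
    field
      f-injective : ∀ {x y} → f x ≡ f y → x ≡ y
      -- M ∖ f(M) has exactly N elements: enumerated injectively by Fin N
      missing     : Fin N → M
      missing-inj : ∀ {i j} → missing i ≡ missing j → i ≡ j
      missing-out : ∀ i y → f y ≢ missing i
      missing-all : ∀ x → ¬ (Σ M λ y → f y ≡ x) → Σ (Fin N) λ i → missing i ≡ x
      aperiodic   : ∀ x n → n ≥ 1 → iter n x ≢ x

LEM : Set₁
LEM = (P : Set) → Dec P

single : ∀ {A : Set} → A → Vector A 1
single x = x ∷ []

module Submission where

-- Since f is injective, aperiodic and misses exactly the N points missing l, M is the disjoint union of
-- N chains missing l, f (missing l), … and of ℤ-chains. By a back-and-forth argument, whether a formula
-- of radius R holds of a tuple depends only on which equations f^s x = f^t y with s, t ≤ R hold between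
-- the tuple, the parameters and the missing points. So the graph of a definable bijection g : M → M ∖ a
-- is, away from the finitely many points near the parameters, a fixed shift: f^s (g x) = f^t x. The
-- injections f^s ∘ g and f^t thus agree outside a finite set, so the complements of their images have
-- the same size; these are s N + k and t N, whence N ∣ k. Conversely f^q is a definable bijection of M
-- onto M minus the q N points of depth < q, and finite sets of equal size are swapped definably.

open import Defs
open import Level using (0ℓ)
open import Data.Nat using (ℕ; zero; suc; _+_; _*_; _≤_; _<_; _≥_; _⊔_; z≤n; s≤s; NonZero; ≢-nonZero⁻¹)
open import Data.Nat.Properties
  using ( +-comm; +-suc; +-identityʳ; +-cancelˡ-≡; +-mono-≤; <-cmp; ≤-refl; ≤-reflexive; ≤-trans; ≤-antisym
        ; ≤-total; <⇒≤; <⇒≱; <⇒≢; m≤m+n; m≤n+m; m≤m⊔n; m≤n⊔m; m<n⇒m<1+n; m+n≮m; m≤n⇒∃[o]m+o≡n)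
open import Data.Nat.Divisibility using (_∣_; divides; ∣m+n∣m⇒∣n; n∣m*n; ∣1⇒≡1)
open import Data.Nat.Tactic.RingSolver using (solve-∀)
open import Data.Fin using (Fin; zero; suc; lift; toℕ; fromℕ<; _↑ˡ_; _↑ʳ_; splitAt; remQuot; combine)
open import Data.Fin.Properties using (any?; toℕ-injective; toℕ<n; toℕ-fromℕ<; remQuot-combine; combine-remQuot)
open import Data.Vec.Functional using (Vector; _∷_; _++_; [])
open import Data.Vec.Functional.Properties using (lookup-++ˡ; lookup-++ʳ)
open import Data.Product using (Σ; _×_; _,_; proj₁; proj₂; uncurry)
open import Data.Product.Function.NonDependent.Propositional using (_×-⇔_)
open import Data.Sum as Sum using (_⊎_; inj₁; inj₂)
open import Data.Sum.Function.Propositional using (_⊎-⇔_)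
open import Data.Empty using (⊥-elim)
open import Data.Unit using (tt)
open import Relation.Nullary using (¬_; yes; no)
open import Relation.Binary.Definitions using (DecidableEquality; tri<; tri≈; tri>)
open import Relation.Binary.Structures using (IsEquivalence)
open import Relation.Binary.PropositionalEquality
open import Function using (_∘_; case_of_)
open import Function.Bundles using (_⇔_; mk⇔; Equivalence)
open import Function.Construct.Identity using (⇔-id)
open import Function.Properties.Equivalence using (⇔-isEquivalence)
open import Function.Related.TypeIsomorphisms using (→-cong-⇔; ¬-cong-⇔)
open import Data.List as List using (List; length; tabulate; deduplicate; concatMap; cartesianProduct; upTo; allFin)
open import Data.List.Properties using (length-++; length-map; length-tabulate)
open import Data.List.Membership.Propositional using (_∈_; _∉_; lose)
open import Data.List.Relation.Unary.Any using (here)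
open import Data.List.Membership.Propositional.Properties
  using ( ∈-map⁺; ∈-map⁻; ∈-++⁺ˡ; ∈-++⁺ʳ; ∈-++⁻; ∈-tabulate⁺; ∈-tabulate⁻; deduplicate-∈⇔
        ; ∈-concatMap⁺; ∈-cartesianProduct⁺; ∈-upTo⁺; ∈-allFin)
open import Data.List.Membership.Propositional.Properties.WithK using (unique∧set⇒bag)
open import Data.List.Relation.Binary.BagAndSetEquality using (∼bag⇒↭)
open import Data.List.Relation.Binary.Permutation.Propositional.Properties using (↭-length)
open import Data.List.Relation.Unary.Unique.Propositional using (Unique)
open import Data.List.Relation.Unary.Unique.Propositional.Properties using (++⁺; map⁺; tabulate⁺)
open import Data.List.Relation.Unary.Unique.DecPropositional.Properties using (deduplicate-!)

open Equivalence using (to; from)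
open IsEquivalence (⇔-isEquivalence {ℓ = 0ℓ}) using () renaming (sym to ⇔-sym; trans to ⇔-trans)

Σ-cong-⇔ : {A : Set} {P Q : A → Set} → (∀ x → P x ⇔ Q x) → Σ A P ⇔ Σ A Q
Σ-cong-⇔ P⇔Q = mk⇔ (λ (x , p) → x , to (P⇔Q x) p) (λ (x , q) → x , from (P⇔Q x) q)

Π-cong-⇔ : {A : Set} {P Q : A → Set} → (∀ x → P x ⇔ Q x) → ((x : A) → P x) ⇔ ((x : A) → Q x)
Π-cong-⇔ P⇔Q = mk⇔ (λ p x → to (P⇔Q x) (p x)) (λ q x → from (P⇔Q x) (q x))

≡-cong-⇔ : {A : Set} {x x′ y y′ : A} → x ≡ x′ → y ≡ y′ → (x ≡ y) ⇔ (x′ ≡ y′)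
≡-cong-⇔ refl refl = ⇔-id _

≡-sym-⇔ : {A : Set} {x y : A} → (x ≡ y) ⇔ (y ≡ x)
≡-sym-⇔ = mk⇔ sym sym

¬×¬⇒⇔ : {A B : Set} → ¬ A → ¬ B → A ⇔ B
¬×¬⇒⇔ ¬a ¬b = mk⇔ (⊥-elim ∘ ¬a) (⊥-elim ∘ ¬b)

renameTerm : ∀ {n n′} → (Fin n → Fin n′) → Term n → Term n′
renameTerm π (var i) = var (π i)
renameTerm π (app t) = app (renameTerm π t)

rename : ∀ {n n′} → (Fin n → Fin n′) → Formula n → Formula n′
rename π (s ≐ t)  = renameTerm π s ≐ renameTerm π t
rename π ⊤'       = ⊤'
rename π ⊥'       = ⊥'
rename π (¬' φ)   = ¬' rename π φ
rename π (φ ∧' ψ) = rename π φ ∧' rename π ψ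
rename π (φ ∨' ψ) = rename π φ ∨' rename π ψ
rename π (φ ⇒' ψ) = rename π φ ⇒' rename π ψ
rename π (∃' φ)   = ∃' (rename (lift 1 π) φ)
rename π (∀' φ)   = ∀' (rename (lift 1 π) φ)

⋀ : ∀ {n k} → (Fin n → Formula k) → Formula k
⋀ {zero}  φs = ⊤'
⋀ {suc n} φs = φs zero ∧' ⋀ (φs ∘ suc)

⋁ : ∀ {n k} → (Fin n → Formula k) → Formula k
⋁ {zero}  φs = ⊥'
⋁ {suc n} φs = φs zero ∨' ⋁ (φs ∘ suc)

f^[_] : ∀ {n} → ℕ → Term n → Term n
f^[ zero  ] t = t
f^[ suc q ] t = app (f^[ q ] t)

depth : ∀ {n} → Term n → ℕ
depth (var i) = 0
depth (app t) = suc (depth t)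

root : ∀ {n} → Term n → Fin n
root (var i) = i
root (app t) = root t

-- A quantifier doubles the radius because extending a pattern by one point (extend-pattern) halves it.
radius : ∀ {n} → Formula n → ℕ
radius (s ≐ t)  = depth s ⊔ depth t
radius ⊤'       = 0
radius ⊥'       = 0
radius (¬' φ)   = radius φ
radius (φ ∧' ψ) = radius φ ⊔ radius ψ
radius (φ ∨' ψ) = radius φ ⊔ radius ψ
radius (φ ⇒' ψ) = radius φ ⊔ radius ψ
radius (∃' φ)   = radius φ + radius φ
radius (∀' φ)   = radius φ + radius φ

∷∷-++-++ : ∀ {A : Set} {m n} (x y : A) (b : Vector A m) (c : Vector A n) →
  ∀ i → (x ∷ y ∷ (b ++ c)) i ≡ (((x ∷ y ∷ []) ++ b) ++ c) i
∷∷-++-++ x y b c zero          = refl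
∷∷-++-++ x y b c (suc zero)    = refl
∷∷-++-++ {m = m} x y b c (suc (suc i)) with splitAt m i
... | inj₁ _ = refl
... | inj₂ _ = refl

∷-lift : ∀ {A : Set} {n n′} {π : Fin n → Fin n′} {ρ : Vector A n′} {σ : Vector A n} (a : A) →
  (∀ i → ρ (π i) ≡ σ i) → ∀ i → (a ∷ ρ) (lift 1 π i) ≡ (a ∷ σ) i
∷-lift a ρπ≗σ zero    = refl
∷-lift a ρπ≗σ (suc i) = ρπ≗σ i

∷-++ : ∀ {A : Set} {m n} (a : A) (ρ : Vector A m) (w : Vector A n) → ∀ i → ((a ∷ ρ) ++ w) i ≡ (a ∷ (ρ ++ w)) i
∷-++ a ρ w zero = refl
∷-++ {m = m} a ρ w (suc i) with splitAt m i
... | inj₁ _ = refl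
... | inj₂ _ = refl

record Enumerates {A : Set} (xs : List A) (P : A → Set) : Set where
  field
    unique  : Unique xs
    members : ∀ {y} → y ∈ xs ⇔ P y

open Enumerates

Image : {A : Set} → (A → A) → A → Set
Image {A} G y = Σ A λ x → G x ≡ y

module _ {A : Set} where

  Enumerates-length : ∀ {xs ys} {P Q : A → Set} → Enumerates xs P → Enumerates ys Q →
    (∀ {y} → P y ⇔ Q y) → length xs ≡ length ys
  Enumerates-length xs⇔P ys⇔Q P⇔Q = ↭-length (∼bag⇒↭ (unique∧set⇒bag (unique xs⇔P) (unique ys⇔Q)
    (⇔-trans (members xs⇔P) (⇔-trans P⇔Q (⇔-sym (members ys⇔Q))))))

  Enumerates-resp : ∀ {xs} {P Q : A → Set} → (∀ {y} → P y ⇔ Q y) → Enumerates xs P → Enumerates xs Q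
  Enumerates-resp P⇔Q xs⇔P = record { unique = unique xs⇔P ; members = ⇔-trans (members xs⇔P) P⇔Q }

  Enumerates-tabulate : ∀ {n} (v : Fin n → A) → (∀ i j → v i ≡ v j → i ≡ j) →
    Enumerates (tabulate v) (λ y → Σ (Fin n) λ i → v i ≡ y)
  Enumerates-tabulate v v-injective = record
    { unique  = tabulate⁺ (v-injective _ _)
    ; members = mk⇔ (λ y∈ → let (i , y≡vᵢ) = ∈-tabulate⁻ y∈ in i , sym y≡vᵢ)
                    (λ (i , vᵢ≡y) → subst (_∈ tabulate v) vᵢ≡y (∈-tabulate⁺ i))
    }

  Enumerates-map : ∀ {xs} {P : A → Set} (h : A → A) → (∀ {x y} → h x ≡ h y → x ≡ y) →
    Enumerates xs P → Enumerates (List.map h xs) (λ y → Σ A λ x → P x × h x ≡ y)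
  Enumerates-map {xs} h h-injective xs⇔P = record
    { unique  = map⁺ h-injective (unique xs⇔P)
    ; members = mk⇔ (λ y∈ → let (x , x∈ , y≡hx) = ∈-map⁻ h y∈ in x , to (members xs⇔P) x∈ , sym y≡hx)
                    (λ (x , Px , hx≡y) → subst (_∈ List.map h xs) hx≡y (∈-map⁺ h (from (members xs⇔P) Px)))
    }

  Enumerates-++ : ∀ {xs ys} {P Q : A → Set} → Enumerates xs P → Enumerates ys Q → (∀ {y} → P y → ¬ Q y) →
    Enumerates (xs List.++ ys) (λ y → P y ⊎ Q y)
  Enumerates-++ {xs} xs⇔P ys⇔Q P∩Q≡∅ = record
    { unique  = ++⁺ (unique xs⇔P) (unique ys⇔Q)
                    (λ (y∈xs , y∈ys) → P∩Q≡∅ (to (members xs⇔P) y∈xs) (to (members ys⇔Q) y∈ys))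
    ; members = mk⇔ (Sum.map (to (members xs⇔P)) (to (members ys⇔Q)) ∘ ∈-++⁻ xs)
                    (λ { (inj₁ Py) → ∈-++⁺ˡ (from (members xs⇔P) Py)
                       ; (inj₂ Qy) → ∈-++⁺ʳ xs (from (members ys⇔Q) Qy) })
    }

module Counting (lem : LEM) {A : Set} where

  ∁Image-∘ : ∀ {xs ys} (h g : A → A) → (∀ {x y} → h x ≡ h y → x ≡ y) →
    Enumerates xs (¬_ ∘ Image h) → Enumerates ys (¬_ ∘ Image g) →
    Enumerates (xs List.++ List.map h ys) (¬_ ∘ Image (h ∘ g))
  ∁Image-∘ h g h-injective xs⇔ ys⇔ =
    Enumerates-resp (mk⇔ missed missed⁻¹) (Enumerates-++ xs⇔ (Enumerates-map h h-injective ys⇔) disjoint)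
    where
      disjoint : ∀ {y} → ¬ Image h y → ¬ (Σ A λ x → ¬ Image g x × h x ≡ y)
      disjoint y∉im (x , _ , hx≡y) = y∉im (x , hx≡y)
      missed : ∀ {y} → ¬ Image h y ⊎ (Σ A λ x → ¬ Image g x × h x ≡ y) → ¬ Image (h ∘ g) y
      missed (inj₁ y∉im) (z , hgz≡y) = y∉im (g z , hgz≡y)
      missed (inj₂ (x , x∉im , hx≡y)) (z , hgz≡y) = x∉im (z , h-injective (trans hgz≡y (sym hx≡y)))
      missed⁻¹ : ∀ {y} → ¬ Image (h ∘ g) y → ¬ Image h y ⊎ (Σ A λ x → ¬ Image g x × h x ≡ y)
      missed⁻¹ {y} y∉im with lem (Image h y)
      ... | no y∉imh          = inj₁ y∉imh
      ... | yes (x , hx≡y)    = inj₂ (x , (λ (z , gz≡x) → y∉im (z , trans (cong h gz≡x) hx≡y)) , hx≡y)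

  ∁Image-length-≡ : ∀ {xs ys} (G H : A → A) →
    (∀ {x y} → G x ≡ G y → x ≡ y) → (∀ {x y} → H x ≡ H y → x ≡ y) →
    (F : List A) → (∀ x → x ∉ F → G x ≡ H x) →
    Enumerates xs (¬_ ∘ Image G) → Enumerates ys (¬_ ∘ Image H) → length xs ≡ length ys
  -- Both map G F′ ++ xs and map H F′ ++ ys enumerate the points that are not hit from outside F.
  ∁Image-length-≡ {xs} {ys} G H G-injective H-injective F G≡H xs⇔ ys⇔ =
    +-cancelˡ-≡ (length F′) (length xs) (length ys) (begin
      length F′ + length xs              ≡⟨ length-F′++ G xs ⟨
      length (List.map G F′ List.++ xs)  ≡⟨ Enumerates-length (enumerate G G-injective xs⇔)
                                                              (enumerate H H-injective ys⇔) same ⟩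
      length (List.map H F′ List.++ ys)  ≡⟨ length-F′++ H ys ⟩
      length F′ + length ys              ∎)
    where
      open ≡-Reasoning
      _≟_ : DecidableEquality A
      x ≟ y = lem (x ≡ y)
      F′ : List A
      F′ = deduplicate _≟_ F
      F′⇔F : Enumerates F′ (_∈ F)
      F′⇔F = record { unique = deduplicate-! _≟_ F ; members = ⇔-sym (deduplicate-∈⇔ _≟_) }
      HitFromOutside : (A → A) → A → Set
      HitFromOutside K y = Σ A λ z → z ∉ F × K z ≡ y
      same : ∀ {y} → (¬ HitFromOutside G y) ⇔ (¬ HitFromOutside H y)
      same = mk⇔ (λ ¬hit (z , z∉F , Hz≡y) → ¬hit (z , z∉F , trans (G≡H z z∉F) Hz≡y))
                 (λ ¬hit (z , z∉F , Gz≡y) → ¬hit (z , z∉F , trans (sym (G≡H z z∉F)) Gz≡y))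
      length-F′++ : ∀ K zs → length (List.map K F′ List.++ zs) ≡ length F′ + length zs
      length-F′++ K zs = trans (length-++ (List.map K F′)) (cong (_+ length zs) (length-map K F′))
      enumerate : ∀ {zs} K → (∀ {x y} → K x ≡ K y → x ≡ y) → Enumerates zs (¬_ ∘ Image K) →
        Enumerates (List.map K F′ List.++ zs) (¬_ ∘ HitFromOutside K)
      enumerate K K-injective zs⇔ =
        Enumerates-resp (mk⇔ missed missed⁻¹)
          (Enumerates-++ (Enumerates-map K K-injective F′⇔F) zs⇔ λ (x , _ , Kx≡y) y∉im → y∉im (x , Kx≡y))
        where
          missed : ∀ {y} → (Σ A λ x → x ∈ F × K x ≡ y) ⊎ ¬ Image K y → ¬ HitFromOutside K y
          missed (inj₁ (x , x∈F , Kx≡y)) (z , z∉F , Kz≡y) =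
            z∉F (subst (_∈ F) (K-injective (trans Kx≡y (sym Kz≡y))) x∈F)
          missed (inj₂ y∉im) (z , _ , Kz≡y) = y∉im (z , Kz≡y)
          missed⁻¹ : ∀ {y} → ¬ HitFromOutside K y → (Σ A λ x → x ∈ F × K x ≡ y) ⊎ ¬ Image K y
          missed⁻¹ {y} ¬hit with lem (Image K y)
          ... | no y∉im = inj₂ y∉im
          ... | yes (z , Kz≡y) with lem (z ∈ F)
          ...   | yes z∈F = inj₁ (z , z∈F , Kz≡y)
          ...   | no z∉F  = ⊥-elim (¬hit (z , z∉F , Kz≡y))

module Definability (𝑀 : Structure) where
  open Structure 𝑀 renaming (Carrier to M)

  f^ : ℕ → M → M
  f^ = iter 𝑀

  f^-+ : ∀ p q x → f^ (p + q) x ≡ f^ p (f^ q x)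
  f^-+ zero    q x = refl
  f^-+ (suc p) q x = cong f (f^-+ p q x)

  f^-sucʳ : ∀ p x → f^ (suc p) x ≡ f^ p (f x)
  f^-sucʳ zero    x = refl
  f^-sucʳ (suc p) x = cong f (f^-sucʳ p x)

  f^-comm : ∀ p q x → f^ p (f^ q x) ≡ f^ q (f^ p x)
  f^-comm p q x = begin
    f^ p (f^ q x) ≡⟨ f^-+ p q x ⟨
    f^ (p + q) x  ≡⟨ cong (λ n → f^ n x) (+-comm p q) ⟩
    f^ (q + p) x  ≡⟨ f^-+ q p x ⟩
    f^ q (f^ p x) ∎
    where open ≡-Reasoning

  f^-injective : (∀ {x y} → f x ≡ f y → x ≡ y) → ∀ p {x y} → f^ p x ≡ f^ p y → x ≡ y
  f^-injective f-injective zero    e = e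
  f^-injective f-injective (suc p) e = f^-injective f-injective p (f-injective e)

  evalT-depth : ∀ {n} (t : Term n) ρ → evalT 𝑀 t ρ ≡ f^ (depth t) (ρ (root t))
  evalT-depth (var i) ρ = refl
  evalT-depth (app t) ρ = cong f (evalT-depth t ρ)

  evalT-f^[] : ∀ {n} q (t : Term n) ρ → evalT 𝑀 (f^[ q ] t) ρ ≡ f^ q (evalT 𝑀 t ρ)
  evalT-f^[] zero    t ρ = refl
  evalT-f^[] (suc q) t ρ = cong f (evalT-f^[] q t ρ)

  evalT-rename : ∀ {n n′} (π : Fin n → Fin n′) (t : Term n) {ρ : Vector M n′} {σ : Vector M n} →
    (∀ i → ρ (π i) ≡ σ i) → evalT 𝑀 (renameTerm π t) ρ ≡ evalT 𝑀 t σ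
  evalT-rename π (var i) ρπ≗σ = ρπ≗σ i
  evalT-rename π (app t) ρπ≗σ = cong f (evalT-rename π t ρπ≗σ)

  Sat-rename : ∀ {n n′} (π : Fin n → Fin n′) (φ : Formula n) {ρ : Vector M n′} {σ : Vector M n} →
    (∀ i → ρ (π i) ≡ σ i) → Sat 𝑀 (rename π φ) ρ ⇔ Sat 𝑀 φ σ
  Sat-rename π (s ≐ t)  H = ≡-cong-⇔ (evalT-rename π s H) (evalT-rename π t H)
  Sat-rename π ⊤'       H = ⇔-id _
  Sat-rename π ⊥'       H = ⇔-id _
  Sat-rename π (¬' φ)   H = ¬-cong-⇔ (Sat-rename π φ H)
  Sat-rename π (φ ∧' ψ) H = Sat-rename π φ H ×-⇔ Sat-rename π ψ H
  Sat-rename π (φ ∨' ψ) H = Sat-rename π φ H ⊎-⇔ Sat-rename π ψ H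
  Sat-rename π (φ ⇒' ψ) H = →-cong-⇔ (Sat-rename π φ H) (Sat-rename π ψ H)
  Sat-rename π (∃' φ)   H = Σ-cong-⇔ λ a → Sat-rename (lift 1 π) φ (∷-lift a H)
  Sat-rename π (∀' φ)   H = Π-cong-⇔ λ a → Sat-rename (lift 1 π) φ (∷-lift a H)

  Sat-⋀ : ∀ {n k} (φs : Fin n → Formula k) ρ → Sat 𝑀 (⋀ φs) ρ ⇔ (∀ i → Sat 𝑀 (φs i) ρ)
  Sat-⋀ {zero}  φs ρ = mk⇔ (λ _ ()) (λ _ → tt)
  Sat-⋀ {suc n} φs ρ = mk⇔
    (λ { (φ₀ , φₛ) zero → φ₀ ; (φ₀ , φₛ) (suc i) → to (Sat-⋀ (φs ∘ suc) ρ) φₛ i })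
    (λ all → all zero , from (Sat-⋀ (φs ∘ suc) ρ) (all ∘ suc))

  Sat-⋁ : ∀ {n k} (φs : Fin n → Formula k) ρ → Sat 𝑀 (⋁ φs) ρ ⇔ Σ (Fin n) λ i → Sat 𝑀 (φs i) ρ
  Sat-⋁ {zero}  φs ρ = mk⇔ (λ ()) (λ ())
  Sat-⋁ {suc n} φs ρ = mk⇔
    (λ { (inj₁ φ₀) → zero , φ₀ ; (inj₂ φₛ) → let (i , φᵢ) = to (Sat-⋁ (φs ∘ suc) ρ) φₛ in suc i , φᵢ })
    (λ { (zero , φ₀) → inj₁ φ₀ ; (suc i , φᵢ) → inj₂ (from (Sat-⋁ (φs ∘ suc) ρ) (i , φᵢ)) })

  Definable₂ : (M → M → Set) → Set
  Definable₂ G = Definable 𝑀 2 (λ v → G (v zero) (v (suc zero)))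

  Definable₂-∘ : ∀ {G₁ G₂ : M → M → Set} → Definable₂ G₁ → Definable₂ G₂ →
    Definable₂ (λ x z → Σ M λ y → G₁ x y × G₂ y z)
  Definable₂-∘ {G₁} {G₂} (m₁ , φ₁ , b₁ , def₁) (m₂ , φ₂ , b₂ , def₂) =
    m₁ + m₂ , ∃' (rename π₁ φ₁ ∧' rename π₂ φ₂) , b₁ ++ b₂ , λ v →
      (λ (y , g₁ , g₂) → y , from (Sat-rename π₁ φ₁ (π₁-env v y)) (proj₁ (def₁ _) g₁)
                           , from (Sat-rename π₂ φ₂ (π₂-env v y)) (proj₁ (def₂ _) g₂))
    , (λ (y , s₁ , s₂) → y , proj₂ (def₁ _) (to (Sat-rename π₁ φ₁ (π₁-env v y)) s₁)
                           , proj₂ (def₂ _) (to (Sat-rename π₂ φ₂ (π₂-env v y)) s₂))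
    where
      -- Under ∃', variable 0 is the middle point y, followed by x, z and the parameters b₁, b₂.
      π₁ : Fin (2 + m₁) → Fin (3 + (m₁ + m₂))
      π₁ zero             = suc zero
      π₁ (suc zero)       = zero
      π₁ (suc (suc i))    = suc (suc (suc (i ↑ˡ m₂)))
      π₂ : Fin (2 + m₂) → Fin (3 + (m₁ + m₂))
      π₂ zero             = zero
      π₂ (suc zero)       = suc (suc zero)
      π₂ (suc (suc i))    = suc (suc (suc (m₁ ↑ʳ i)))
      π₁-env : ∀ (v : Vector M 2) y i → (y ∷ (v ++ (b₁ ++ b₂))) (π₁ i) ≡ ((v zero ∷ y ∷ []) ++ b₁) i
      π₁-env v y zero          = refl
      π₁-env v y (suc zero)    = refl
      π₁-env v y (suc (suc i)) = lookup-++ˡ b₁ b₂ i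
      π₂-env : ∀ (v : Vector M 2) y i → (y ∷ (v ++ (b₁ ++ b₂))) (π₂ i) ≡ ((y ∷ v (suc zero) ∷ []) ++ b₂) i
      π₂-env v y zero          = refl
      π₂-env v y (suc zero)    = refl
      π₂-env v y (suc (suc i)) = lookup-++ʳ b₁ b₂ i

  DefBijection-∘ : ∀ {A B C : M → Set} → DefBijection 𝑀 A B → DefBijection 𝑀 B C → DefBijection 𝑀 A C
  DefBijection-∘ {A} {B} {C} ((h₁ , h₁-injective) , h₁-onto) ((h₂ , h₂-injective) , h₂-onto) =
    (h , injective) , onto
    where
      module h₁ = DefMap h₁
      module h₂ = DefMap h₂
      Graph : M → M → Set
      Graph x z = Σ M λ y → h₁.Graph x y × h₂.Graph y z
      h : DefMap 𝑀 A C
      h = record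
        { Graph      = Graph
        ; definable  = Definable₂-∘ {h₁.Graph} {h₂.Graph} h₁.definable h₂.definable
        ; graph⊆     = λ (_ , g₁ , g₂) → proj₁ (h₁.graph⊆ g₁) , proj₂ (h₂.graph⊆ g₂)
        ; total      = λ a → let (y , g₁) = h₁.total a
                                 (z , g₂) = h₂.total (proj₂ (h₁.graph⊆ g₁))
                             in z , y , g₁ , g₂
        ; functional = λ (_ , g₁ , g₂) (_ , g₁′ , g₂′) →
            h₂.functional g₂ (subst (λ y → h₂.Graph y _) (h₁.functional g₁′ g₁) g₂′)
        }
      injective : ∀ {x x′ z} → Graph x z → Graph x′ z → x ≡ x′
      injective (_ , g₁ , g₂) (_ , g₁′ , g₂′) =
        h₁-injective g₁ (subst (h₁.Graph _) (h₂-injective g₂′ g₂) g₁′)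
      onto : ∀ {z} → C z → Σ M λ x → Graph x z
      onto cz = let (y , g₂) = h₂-onto cz
                    (x , g₁) = h₁-onto (proj₁ (h₂.graph⊆ g₂))
                in x , y , g₁ , g₂

  DefMap-mono-codomain : ∀ {A B B′ : M → Set} → (∀ {y} → B y → B′ y) → DefMap 𝑀 A B → DefMap 𝑀 A B′
  DefMap-mono-codomain B⊆B′ h = record
    { Graph      = Graph
    ; definable  = definable
    ; graph⊆     = λ g → proj₁ (graph⊆ g) , B⊆B′ (proj₂ (graph⊆ g))
    ; total      = total
    ; functional = functional
    }
    where open DefMap h

  DefBijection-resp-codomain : ∀ {A B B′ : M → Set} → (∀ {y} → B y ⇔ B′ y) →
    DefBijection 𝑀 A B → DefBijection 𝑀 A B′
  DefBijection-resp-codomain B⇔B′ ((h , injective) , onto) =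
    (DefMap-mono-codomain (to B⇔B′) h , injective) , onto ∘ from B⇔B′

  inclusion-deprived : ∀ x → DefInjection 𝑀 (Deprived 𝑀 (single x)) (Whole 𝑀)
  inclusion-deprived x = h , λ (_ , z≡y) (_ , z≡y′) → trans (sym z≡y) z≡y′
    where
      h : DefMap 𝑀 (Deprived 𝑀 (single x)) (Whole 𝑀)
      h = record
        { Graph      = λ y z → (y ≢ x) × (z ≡ y)
        ; definable  = 1 , (¬' (var zero ≐ var (suc (suc zero)))) ∧' (var (suc zero) ≐ var zero)
                         , single x , λ _ → (λ g → g) , (λ g → g)
        ; graph⊆     = λ (y≢x , _) → (λ { zero → y≢x }) , tt
        ; total      = λ {y} y≢x → y , y≢x zero , refl
        ; functional = λ (_ , z≡y) (_ , z′≡y) → trans z≡y (sym z′≡y)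
        }

  f^-DefBijection : (∀ {x y} → f x ≡ f y → x ≡ y) → ∀ q →
    DefBijection 𝑀 (Whole 𝑀) (Image (f^ q))
  f^-DefBijection f-injective q = (h , λ e e′ → f^-injective f-injective q (trans e (sym e′))) , λ y∈im → y∈im
    where
      h : DefMap 𝑀 (Whole 𝑀) (Image (f^ q))
      h = record
        { Graph      = λ x y → f^ q x ≡ y
        ; definable  = 0 , f^[ q ] (var zero) ≐ var (suc zero) , [] , λ v →
            (trans (evalT-f^[] q (var zero) (v ++ [])))
          , (trans (sym (evalT-f^[] q (var zero) (v ++ []))))
        ; graph⊆     = λ {x} e → tt , (x , e)
        ; total      = λ {x} _ → f^ q x , refl
        ; functional = λ e e′ → trans (sym e) e′
        }

  SwapGraph : ∀ {n} → Vector M n → Vector M n → M → M → Set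
  SwapGraph {n} P Q x y = Deprived 𝑀 P x × ((Σ (Fin n) λ i → x ≡ Q i × y ≡ P i) ⊎ (Deprived 𝑀 Q x × y ≡ x))

  SwapGraph-definable : ∀ {n} (P Q : Vector M n) → Definable₂ (SwapGraph P Q)
  SwapGraph-definable {n} P Q = n + n , graph , P ++ Q , λ v → from (Sat-graph v) , to (Sat-graph v)
    where
      X Y : Term (2 + (n + n))
      X = var zero
      Y = var (suc zero)
      P′ Q′ : Fin n → Term (2 + (n + n))
      P′ i = var (suc (suc (i ↑ˡ n)))
      Q′ i = var (suc (suc (n ↑ʳ i)))
      graph : Formula (2 + (n + n))
      graph = ⋀ (λ i → ¬' (X ≐ P′ i))
           ∧' (⋁ (λ i → (X ≐ Q′ i) ∧' (Y ≐ P′ i)) ∨' (⋀ (λ i → ¬' (X ≐ Q′ i)) ∧' (Y ≐ X)))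
      Sat-graph : ∀ v → Sat 𝑀 graph (v ++ (P ++ Q)) ⇔ SwapGraph P Q (v zero) (v (suc zero))
      Sat-graph v =
        ⇔-trans (Sat-⋀ _ ρ) (Π-cong-⇔ λ i → ¬-cong-⇔ (≡-cong-⇔ refl (P′≡P i)))
        ×-⇔ (⇔-trans (Sat-⋁ _ ρ) (Σ-cong-⇔ λ i → ≡-cong-⇔ refl (Q′≡Q i) ×-⇔ ≡-cong-⇔ refl (P′≡P i))
             ⊎-⇔ (⇔-trans (Sat-⋀ _ ρ) (Π-cong-⇔ λ i → ¬-cong-⇔ (≡-cong-⇔ refl (Q′≡Q i))) ×-⇔ ⇔-id _))
        where
          ρ = v ++ (P ++ Q)
          P′≡P = lookup-++ˡ P Q
          Q′≡Q = lookup-++ʳ P Q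

  swap-DefBijection : DecidableEquality M → ∀ {n} (P Q : Vector M n) →
    (∀ i j → P i ≡ P j → i ≡ j) → (∀ i j → Q i ≡ Q j → i ≡ j) → (∀ i j → P i ≢ Q j) →
    DefBijection 𝑀 (Deprived 𝑀 P) (Deprived 𝑀 Q)
  swap-DefBijection _≟_ {n} P Q P-injective Q-injective P∩Q≡∅ = (h , injective) , onto
    where
      Graph = SwapGraph P Q
      h : DefMap 𝑀 (Deprived 𝑀 P) (Deprived 𝑀 Q)
      h = record
        { Graph      = Graph
        ; definable  = SwapGraph-definable P Q
        ; graph⊆     = λ where
            (x∉P , inj₁ (i , _ , y≡P)) → x∉P , λ j y≡Q → P∩Q≡∅ i j (trans (sym y≡P) y≡Q)
            (x∉P , inj₂ (x∉Q , y≡x))   → x∉P , λ j y≡Q → x∉Q j (trans (sym y≡x) y≡Q)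
        ; total      = λ {x} x∉P → case any? (λ i → x ≟ Q i) of λ where
            (yes (i , x≡Q)) → P i , x∉P , inj₁ (i , x≡Q , refl)
            (no x∉Q)        → x , x∉P , inj₂ ((λ i e → x∉Q (i , e)) , refl)
        ; functional = λ where
            (_ , inj₁ (i , x≡Q , y≡P)) (_ , inj₁ (i′ , x≡Q′ , y′≡P)) →
              trans y≡P (trans (cong P (Q-injective i i′ (trans (sym x≡Q) x≡Q′))) (sym y′≡P))
            (_ , inj₁ (i , x≡Q , _)) (_ , inj₂ (x∉Q , _)) → ⊥-elim (x∉Q i x≡Q)
            (_ , inj₂ (x∉Q , _)) (_ , inj₁ (i , x≡Q , _)) → ⊥-elim (x∉Q i x≡Q)
            (_ , inj₂ (_ , y≡x)) (_ , inj₂ (_ , y′≡x)) → trans y≡x (sym y′≡x)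
        }
      injective : ∀ {x x′ y} → Graph x y → Graph x′ y → x ≡ x′
      injective (_ , inj₁ (i , x≡Q , y≡P)) (_ , inj₁ (i′ , x′≡Q , y≡P′)) =
        trans x≡Q (trans (cong Q (P-injective i i′ (trans (sym y≡P) y≡P′))) (sym x′≡Q))
      injective (_ , inj₁ (i , _ , y≡P)) (x′∉P , inj₂ (_ , y≡x′)) = ⊥-elim (x′∉P i (trans (sym y≡x′) y≡P))
      injective (x∉P , inj₂ (_ , y≡x)) (_ , inj₁ (i , _ , y≡P)) = ⊥-elim (x∉P i (trans (sym y≡x) y≡P))
      injective (_ , inj₂ (_ , y≡x)) (_ , inj₂ (_ , y≡x′)) = trans (sym y≡x) y≡x′
      onto : ∀ {y} → Deprived 𝑀 Q y → Σ M λ x → Graph x y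
      onto {y} y∉Q = case any? (λ i → y ≟ P i) of λ where
        (yes (i , y≡P)) → Q i , (λ j Q≡P → P∩Q≡∅ j i (sym Q≡P)) , inj₁ (i , refl , y≡P)
        (no y∉P)        → y , (λ i e → y∉P (i , e)) , inj₂ (y∉Q , refl)

module Model (lem : LEM) {N : ℕ} (𝑀 : Structure) (T : IsModelT 𝑀 N) (i₀ : Fin N) where
  open Structure 𝑀 renaming (Carrier to M)
  open IsModelT T
  open Definability 𝑀
  open Counting lem

  f^-inj : ∀ p {x y} → f^ p x ≡ f^ p y → x ≡ y
  f^-inj = f^-injective f-injective

  f^-<-≢ : ∀ {p q} x → p < q → f^ p x ≢ f^ q x
  f^-<-≢ {p} x p<q e with m≤n⇒∃[o]m+o≡n p<q
  ... | d , refl = aperiodic x (suc d) (s≤s z≤n) (f^-inj p (begin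
    f^ p (f^ (suc d) x) ≡⟨ f^-+ p (suc d) x ⟨
    f^ (p + suc d) x    ≡⟨ cong (λ n → f^ n x) (+-suc p d) ⟩
    f^ (suc p + d) x    ≡⟨ e ⟨
    f^ p x              ∎))
    where open ≡-Reasoning

  f^-aperiodic : ∀ {p q} x → f^ p x ≡ f^ q x → p ≡ q
  f^-aperiodic {p} {q} x e with <-cmp p q
  ... | tri< p<q _ _ = ⊥-elim (f^-<-≢ x p<q e)
  ... | tri≈ _ p≡q _ = p≡q
  ... | tri> _ _ q<p = ⊥-elim (f^-<-≢ x q<p (sym e))

  f^-missing-≤ : ∀ p l {q} z → f^ p (missing l) ≡ f^ q z → q ≤ p
  f^-missing-≤ p l {q} z e with ≤-total q p
  ... | inj₁ q≤p = q≤p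
  ... | inj₂ p≤q with m≤n⇒∃[o]m+o≡n p≤q
  ...   | zero  , refl = ≤-reflexive (+-identityʳ p)
  ...   | suc d , refl = ⊥-elim (missing-out l (f^ d z) (sym (f^-inj p (trans e (f^-+ p (suc d) z)))))

  f^-missing-injective : ∀ {p q l l′} → f^ p (missing l) ≡ f^ q (missing l′) → p ≡ q × l ≡ l′
  f^-missing-injective {p} {q} {l} {l′} e =
    p≡q , missing-inj (f^-inj p (trans e (cong (λ n → f^ n (missing l′)) (sym p≡q))))
    where
      p≡q : p ≡ q
      p≡q = ≤-antisym (f^-missing-≤ q l′ (missing l) (sym e)) (f^-missing-≤ p l (missing l′) e)

  Shallow : ℕ → M → Set
  Shallow q y = Σ (Fin N) λ l → Σ ℕ λ p → p < q × f^ p (missing l) ≡ y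

  image-or-shallow : ∀ q y → Image (f^ q) y ⊎ Shallow q y
  image-or-shallow zero    y = inj₁ (y , refl)
  image-or-shallow (suc q) y with image-or-shallow q y
  ... | inj₂ (l , p , p<q , e) = inj₂ (l , p , m<n⇒m<1+n p<q , e)
  ... | inj₁ (z , f^z≡y) with lem (Image f z)
  ...   | yes (x , fx≡z) = inj₁ (x , trans (f^-sucʳ q x) (trans (cong (f^ q) fx≡z) f^z≡y))
  ...   | no z∉im = let (l , mₗ≡z) = missing-all z z∉im in
                    inj₂ (l , q , ≤-refl , trans (cong (f^ q) mₗ≡z) f^z≡y)

  image-shallow-disjoint : ∀ {q y} → Image (f^ q) y → ¬ Shallow q y
  image-shallow-disjoint {q} (z , f^z≡y) (l , p , p<q , e) =
    <⇒≱ p<q (f^-missing-≤ p l z (trans e (sym f^z≡y)))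

  chain-point : ∀ {q} → Fin q × Fin N → M
  chain-point (p , l) = f^ (toℕ p) (missing l)

  -- The q N points of depth < q, indexed through Fin (q * N) ≅ Fin q × Fin N.
  shallow : ∀ q → Vector M (q * N)
  shallow q i = chain-point (remQuot {q} N i)

  shallow-injective : ∀ q i j → shallow q i ≡ shallow q j → i ≡ j
  shallow-injective q i j e = begin
    i                                  ≡⟨ combine-remQuot {q} N i ⟨
    uncurry combine (remQuot {q} N i)  ≡⟨ cong (uncurry combine) remQuot≡ ⟩
    uncurry combine (remQuot {q} N j)  ≡⟨ combine-remQuot {q} N j ⟩
    j                                  ∎
    where
      open ≡-Reasoning
      remQuot≡ : remQuot {q} N i ≡ remQuot N j
      remQuot≡ = let (p≡p′ , l≡l′) = f^-missing-injective e in cong₂ _,_ (toℕ-injective p≡p′) l≡l′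

  shallow⇔Shallow : ∀ q {y} → (Σ (Fin (q * N)) λ i → shallow q i ≡ y) ⇔ Shallow q y
  shallow⇔Shallow q = mk⇔
    (λ (i , e) → let (p , l) = remQuot {q} N i in l , toℕ p , toℕ<n p , e)
    (λ (l , p , p<q , e) → combine (fromℕ< p<q) l , (begin
      shallow q (combine (fromℕ< p<q) l)  ≡⟨ cong chain-point (remQuot-combine (fromℕ< p<q) l) ⟩
      f^ (toℕ (fromℕ< p<q)) (missing l)   ≡⟨ cong (λ n → f^ n (missing l)) (toℕ-fromℕ< p<q) ⟩
      f^ p (missing l)                    ≡⟨ e ⟩
      _                                   ∎))
    where open ≡-Reasoning

  Image⇔Deprived-shallow : ∀ q {y} → Image (f^ q) y ⇔ Deprived 𝑀 (shallow q) y
  Image⇔Deprived-shallow q {y} = mk⇔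
    (λ y∈im i y≡ → image-shallow-disjoint y∈im (to (shallow⇔Shallow q) (i , sym y≡)))
    (λ y∉shallow → case image-or-shallow q y of λ where
      (inj₁ y∈im)      → y∈im
      (inj₂ y-shallow) → let (i , e) = from (shallow⇔Shallow q) y-shallow in ⊥-elim (y∉shallow i (sym e)))

  shallow-enumerates : ∀ q → Enumerates (tabulate (shallow q)) (¬_ ∘ Image (f^ q))
  shallow-enumerates q = Enumerates-resp (mk⇔
      (λ shallow-y y∈im → image-shallow-disjoint y∈im (to (shallow⇔Shallow q) shallow-y))
      (λ y∉im → case image-or-shallow q _ of λ where
        (inj₁ y∈im)      → ⊥-elim (y∉im y∈im)
        (inj₂ y-shallow) → from (shallow⇔Shallow q) y-shallow))
    (Enumerates-tabulate (shallow q) (shallow-injective q))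

  SamePattern : ∀ {n} → ℕ → Vector M n → Vector M n → Set
  SamePattern R u v = ∀ i j s t → s ≤ R → t ≤ R → (f^ s (u i) ≡ f^ t (u j)) ⇔ (f^ s (v i) ≡ f^ t (v j))

  SamePattern-refl : ∀ {n R} (u : Vector M n) → SamePattern R u u
  SamePattern-refl u _ _ _ _ _ _ = ⇔-id _

  SamePattern-sym : ∀ {n R} {u v : Vector M n} → SamePattern R u v → SamePattern R v u
  SamePattern-sym P i j s t s≤R t≤R = ⇔-sym (P i j s t s≤R t≤R)

  SamePattern-mono : ∀ {n R R′} {u v : Vector M n} → R′ ≤ R → SamePattern R u v → SamePattern R′ u v
  SamePattern-mono R′≤R P i j s t s≤R′ t≤R′ = P i j s t (≤-trans s≤R′ R′≤R) (≤-trans t≤R′ R′≤R)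

  SamePattern-resp : ∀ {n R} {u u′ v v′ : Vector M n} → (∀ i → u i ≡ u′ i) → (∀ i → v i ≡ v′ i) →
    SamePattern R u v → SamePattern R u′ v′
  SamePattern-resp u≗u′ v≗v′ P i j s t s≤R t≤R =
    ⇔-trans (≡-cong-⇔ (cong (f^ s) (sym (u≗u′ i))) (cong (f^ t) (sym (u≗u′ j))))
      (⇔-trans (P i j s t s≤R t≤R) (≡-cong-⇔ (cong (f^ s) (v≗v′ i)) (cong (f^ t) (v≗v′ j))))

  SamePattern-swap : ∀ {n R} {a b a′ b′ : M} {u v : Vector M n} →
    SamePattern R (a ∷ b ∷ u) (a′ ∷ b′ ∷ v) → SamePattern R (b ∷ a ∷ u) (b′ ∷ a′ ∷ v)
  SamePattern-swap {n} P = SamePattern-resp swapped swapped (λ i j → P (swap i) (swap j))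
    where
      swap : Fin (2 + n) → Fin (2 + n)
      swap zero          = suc zero
      swap (suc zero)    = zero
      swap (suc (suc i)) = suc (suc i)
      swapped : ∀ {c d : M} {z : Vector M n} i → (c ∷ d ∷ z) (swap i) ≡ (d ∷ c ∷ z) i
      swapped zero          = refl
      swapped (suc zero)    = refl
      swapped (suc (suc i)) = refl

  SamePattern-∷ : ∀ {n R} {u v : Vector M n} a a′ → SamePattern R u v →
    (∀ j s t → s ≤ R → t ≤ R → (f^ s a ≡ f^ t (u j)) ⇔ (f^ s a′ ≡ f^ t (v j))) →
    SamePattern R (a ∷ u) (a′ ∷ v)
  SamePattern-∷ a a′ P P₀ zero    zero    s t _   _   =
    mk⇔ (cong (λ n → f^ n a′) ∘ f^-aperiodic {s} {t} a) (cong (λ n → f^ n a) ∘ f^-aperiodic {s} {t} a′)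
  SamePattern-∷ a a′ P P₀ zero    (suc j) s t s≤R t≤R = P₀ j s t s≤R t≤R
  SamePattern-∷ a a′ P P₀ (suc i) zero    s t s≤R t≤R =
    ⇔-trans ≡-sym-⇔ (⇔-trans (P₀ i t s t≤R s≤R) ≡-sym-⇔)
  SamePattern-∷ a a′ P P₀ (suc i) (suc j) s t s≤R t≤R = P i j s t s≤R t≤R

  Far : ∀ {n} → ℕ → Vector M n → M → Set
  Far R v a = ∀ j s t → s ≤ R → t ≤ R → f^ s a ≢ f^ t (v j)

  orbit-bound : ∀ x {n} (v : Vector M n) → Σ ℕ λ B → ∀ j m → f^ m x ≡ v j → m < B
  orbit-bound x {zero}  v = 0 , λ ()
  orbit-bound x {suc n} v with orbit-bound x (v ∘ suc) | lem (Σ ℕ λ m → f^ m x ≡ v zero)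
  ... | B , bound | no v₀∉orbit = B , λ where
    zero    m e → ⊥-elim (v₀∉orbit (m , e))
    (suc j) m e → bound j m e
  ... | B , bound | yes (m₀ , e₀) = B + suc m₀ , λ where
    zero    m e → subst (_< B + suc m₀) (sym (f^-aperiodic x (trans e (sym e₀)))) (m≤n+m (suc m₀) B)
    (suc j) m e → ≤-trans (bound j m e) (m≤m+n B (suc m₀))

  far-point : ∀ {n} R (v : Vector M n) → Σ M (Far R v)
  far-point R v with orbit-bound (missing i₀) v
  ... | B , bound = f^ (B + R) x₀ , far
    where
      x₀ = missing i₀
      far : Far R v (f^ (B + R) x₀)
      far j s t _ t≤R e with m≤n⇒∃[o]m+o≡n t≤R
      ... | r , refl = <⇒≱ (bound j (s + B + r) (f^-inj t (begin
        f^ t (f^ (s + B + r) x₀)    ≡⟨ f^-+ t (s + B + r) x₀ ⟨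
        f^ (t + (s + B + r)) x₀     ≡⟨ cong (λ n → f^ n x₀) (shuffle t s B r) ⟩
        f^ (s + (B + (t + r))) x₀   ≡⟨ f^-+ s (B + (t + r)) x₀ ⟩
        f^ s (f^ (B + (t + r)) x₀)  ≡⟨ e ⟩
        f^ t (v j)                  ∎)))
        (≤-trans (m≤n+m B s) (m≤m+n (s + B) r))
        where
          open ≡-Reasoning
          shuffle : ∀ t s B r → t + (s + B + r) ≡ s + (B + (t + r))
          shuffle = solve-∀

  SharesMissing : ∀ {n} → Vector M n → Vector M n → Set
  SharesMissing {n} u v = ∀ l → Σ (Fin n) λ j → u j ≡ missing l × v j ≡ missing l

  f^-shift-⇔ : ∀ {s t a x} p q y → f^ s a ≡ f^ t x → (f^ p a ≡ f^ q y) ⇔ (f^ (p + t) x ≡ f^ (q + s) y)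
  f^-shift-⇔ {s} {t} {a} {x} p q y e = mk⇔
    (λ e₁ → begin
      f^ (p + t) x   ≡⟨ f^-+ p t x ⟩
      f^ p (f^ t x)  ≡⟨ cong (f^ p) e ⟨
      f^ p (f^ s a)  ≡⟨ f^-comm p s a ⟩
      f^ s (f^ p a)  ≡⟨ cong (f^ s) e₁ ⟩
      f^ s (f^ q y)  ≡⟨ f^-comm s q y ⟩
      f^ q (f^ s y)  ≡⟨ f^-+ q s y ⟨
      f^ (q + s) y   ∎)
    (λ e₂ → f^-inj s (begin
      f^ s (f^ p a)  ≡⟨ f^-comm s p a ⟩
      f^ p (f^ s a)  ≡⟨ cong (f^ p) e ⟩
      f^ p (f^ t x)  ≡⟨ f^-+ p t x ⟨
      f^ (p + t) x   ≡⟨ e₂ ⟩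
      f^ (q + s) y   ≡⟨ f^-+ q s y ⟩
      f^ q (f^ s y)  ≡⟨ f^-comm q s y ⟩
      f^ s (f^ q y)  ∎))
    where open ≡-Reasoning

  matching-point : ∀ {n R} {u v : Vector M n} → SharesMissing u v → SamePattern (R + R) u v →
    ∀ {a i s t} → s ≤ R → t ≤ R → f^ s a ≡ f^ t (u i) → Σ M λ a′ → f^ s a′ ≡ f^ t (v i)
  matching-point {R = R} {u} {v} shares P {a} {i} {s} {t} s≤R t≤R e with ≤-total s t
  ... | inj₁ s≤t with m≤n⇒∃[o]m+o≡n s≤t
  ...   | d , refl = f^ d (v i) , sym (f^-+ s d (v i))
  matching-point {R = R} {u} {v} shares P {a} {i} {s} {t} s≤R t≤R e | inj₂ t≤s with m≤n⇒∃[o]m+o≡n t≤s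
  ...   | d , refl with image-or-shallow d (v i)
  ...     | inj₁ (z , f^z≡vᵢ) = z , trans (f^-+ t d z) (cong (f^ t) f^z≡vᵢ)
  ...     | inj₂ (l , q , q<d , f^mₗ≡vᵢ) = ⊥-elim (<⇒≱ q<d (f^-missing-≤ q l a (trans f^mₗ≡uᵢ (sym f^a≡uᵢ))))
    where
      f^a≡uᵢ : f^ d a ≡ u i
      f^a≡uᵢ = f^-inj t (trans (sym (f^-+ t d a)) e)
      q≤R+R : q ≤ R + R
      q≤R+R = ≤-trans (<⇒≤ q<d) (≤-trans (m≤n+m d t) (≤-trans s≤R (m≤m+n R R)))
      f^mₗ≡uᵢ : f^ q (missing l) ≡ u i
      f^mₗ≡uᵢ = let (j , uⱼ≡mₗ , vⱼ≡mₗ) = shares l in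
        trans (cong (f^ q) (sym uⱼ≡mₗ)) (from (P j i q 0 q≤R+R z≤n) (trans (cong (f^ q) vⱼ≡mₗ) f^mₗ≡vᵢ))

  extend-pattern : ∀ {n} R {u v : Vector M n} → SharesMissing u v → SamePattern (R + R) u v →
    ∀ a → Σ M λ a′ → SamePattern R (a ∷ u) (a′ ∷ v)
  extend-pattern {n} R {u} {v} shares P a
    with lem (Σ (Fin n) λ i → Σ ℕ λ s → Σ ℕ λ t → s ≤ R × t ≤ R × f^ s a ≡ f^ t (u i))
  ... | yes (i , s , t , s≤R , t≤R , e) =
    let (a′ , e′) = matching-point shares P s≤R t≤R e in
    a′ , SamePattern-∷ a a′ (SamePattern-mono (m≤m+n R R) P) λ j p q p≤R q≤R →
      ⇔-trans (f^-shift-⇔ p q (u j) e)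
        (⇔-trans (P i j (p + t) (q + s) (+-mono-≤ p≤R t≤R) (+-mono-≤ q≤R s≤R))
          (⇔-sym (f^-shift-⇔ p q (v j) e′)))
  ... | no a-far =
    let (a′ , a′-far) = far-point R v in
    a′ , SamePattern-∷ a a′ (SamePattern-mono (m≤m+n R R) P) λ j s t s≤R t≤R →
      ¬×¬⇒⇔ (λ e → a-far (j , s , t , s≤R , t≤R , e)) (a′-far j s t s≤R t≤R)

  extend-environment : ∀ {n} R {ρ ρ′ : Vector M n} → SamePattern (R + R) (ρ ++ missing) (ρ′ ++ missing) →
    ∀ a → Σ M λ a′ → SamePattern R ((a ∷ ρ) ++ missing) ((a′ ∷ ρ′) ++ missing)
  extend-environment {n} R {ρ} {ρ′} P a =
    let (a′ , P′) = extend-pattern R shares P a in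
    a′ , SamePattern-resp (λ i → sym (∷-++ a ρ missing i)) (λ i → sym (∷-++ a′ ρ′ missing i)) P′
    where
      shares : SharesMissing (ρ ++ missing) (ρ′ ++ missing)
      shares l = n ↑ʳ l , lookup-++ʳ ρ missing l , lookup-++ʳ ρ′ missing l

  Sat-invariant : ∀ {n} (φ : Formula n) {ρ ρ′ : Vector M n} →
    SamePattern (radius φ) (ρ ++ missing) (ρ′ ++ missing) → Sat 𝑀 φ ρ ⇔ Sat 𝑀 φ ρ′
  Sat-invariant {n} (s ≐ t) {ρ} {ρ′} P =
    ⇔-trans (≡-cong-⇔ (evalT-at ρ s) (evalT-at ρ t))
      (⇔-trans (P (root s ↑ˡ N) (root t ↑ˡ N) (depth s) (depth t) (m≤m⊔n _ _) (m≤n⊔m _ _))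
        (⇔-sym (≡-cong-⇔ (evalT-at ρ′ s) (evalT-at ρ′ t))))
    where
      evalT-at : ∀ (σ : Vector M n) u → evalT 𝑀 u σ ≡ f^ (depth u) ((σ ++ missing) (root u ↑ˡ N))
      evalT-at σ u = trans (evalT-depth u σ) (cong (f^ (depth u)) (sym (lookup-++ˡ σ missing (root u))))
  Sat-invariant ⊤'       P = ⇔-id _
  Sat-invariant ⊥'       P = ⇔-id _
  Sat-invariant (¬' φ)   P = ¬-cong-⇔ (Sat-invariant φ P)
  Sat-invariant (φ ∧' ψ) P =
    Sat-invariant φ (SamePattern-mono (m≤m⊔n _ _) P) ×-⇔ Sat-invariant ψ (SamePattern-mono (m≤n⊔m _ _) P)
  Sat-invariant (φ ∨' ψ) P =
    Sat-invariant φ (SamePattern-mono (m≤m⊔n _ _) P) ⊎-⇔ Sat-invariant ψ (SamePattern-mono (m≤n⊔m _ _) P)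
  Sat-invariant (φ ⇒' ψ) P =
    →-cong-⇔ (Sat-invariant φ (SamePattern-mono (m≤m⊔n _ _) P)) (Sat-invariant ψ (SamePattern-mono (m≤n⊔m _ _) P))
  Sat-invariant (∃' φ)   P = mk⇔ (witness P) (witness (SamePattern-sym P))
    where
      witness : ∀ {ρ ρ′} → SamePattern (radius φ + radius φ) (ρ ++ missing) (ρ′ ++ missing) →
        Σ M (λ a → Sat 𝑀 φ (a ∷ ρ)) → Σ M (λ a′ → Sat 𝑀 φ (a′ ∷ ρ′))
      witness P (a , sat) = let (a′ , P′) = extend-environment (radius φ) P a in a′ , to (Sat-invariant φ P′) sat
  Sat-invariant (∀' φ)   P = mk⇔ (specialise (SamePattern-sym P)) (specialise P)
    where
      specialise : ∀ {ρ ρ′} → SamePattern (radius φ + radius φ) (ρ′ ++ missing) (ρ ++ missing) →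
        ((a : M) → Sat 𝑀 φ (a ∷ ρ)) → (a′ : M) → Sat 𝑀 φ (a′ ∷ ρ′)
      specialise P all a′ = let (a , P′) = extend-environment (radius φ) P a′ in from (Sat-invariant φ P′) (all a)

  preimage : ℕ → M → List M
  preimage s y with lem (Image (f^ s) y)
  ... | yes (z , _) = z List.∷ List.[]
  ... | no _        = List.[]

  ∈-preimage : ∀ {s z y} → f^ s z ≡ y → z ∈ preimage s y
  ∈-preimage {s} {z} {y} e with lem (Image (f^ s) y)
  ... | yes (z′ , e′) = here (f^-inj s (trans e (sym e′)))
  ... | no y∉im       = ⊥-elim (y∉im (z , e))

  module Necessity {k} (a : Vector M k) (a-injective : ∀ i j → a i ≡ a j → i ≡ j)
                   (bijection : DefBijection 𝑀 (Whole 𝑀) (Deprived 𝑀 a)) where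
    open DefMap (proj₁ (proj₁ bijection))

    g : M → M
    g x = proj₁ (total {x} tt)

    g-graph : ∀ x → Graph x (g x)
    g-graph x = proj₂ (total {x} tt)

    graph⇒g : ∀ {x y} → Graph x y → g x ≡ y
    graph⇒g = functional (g-graph _)

    g-injective : ∀ {x x′} → g x ≡ g x′ → x ≡ x′
    g-injective {x} {x′} e = proj₂ (proj₁ bijection) (g-graph x) (subst (Graph x′) (sym e) (g-graph x′))

    ∁Image-g : Enumerates (tabulate a) (¬_ ∘ Image g)
    ∁Image-g = Enumerates-resp (λ {y} → mk⇔
        (λ (i , aᵢ≡y) (x , gx≡y) → proj₂ (graph⊆ (g-graph x)) i (trans gx≡y (sym aᵢ≡y)))
        (λ y∉im → case lem (Σ (Fin k) λ i → a i ≡ y) of λ where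
          (yes y∈a) → y∈a
          (no y∉a)  → let (x , gxy) = proj₂ bijection (λ i y≡aᵢ → y∉a (i , sym y≡aᵢ)) in
                      ⊥-elim (y∉im (x , graph⇒g gxy))))
      (Enumerates-tabulate a a-injective)

    m : ℕ
    m = proj₁ definable

    φ : Formula (2 + m)
    φ = proj₁ (proj₂ definable)

    b : Vector M m
    b = proj₁ (proj₂ (proj₂ definable))

    φ-defines : ∀ v → (Graph (v zero) (v (suc zero)) → Sat 𝑀 φ (v ++ b))
                    × (Sat 𝑀 φ (v ++ b) → Graph (v zero) (v (suc zero)))
    φ-defines = proj₂ (proj₂ (proj₂ definable))

    w : Vector M (m + N)
    w = b ++ missing

    R D : ℕ
    R = radius φ
    D = R + R

    graph-invariant : ∀ {x y x′ y′} → SamePattern R (x ∷ y ∷ w) (x′ ∷ y′ ∷ w) → Graph x y → Graph x′ y′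
    graph-invariant {x} {y} {x′} {y′} P gxy =
      proj₂ (φ-defines (x′ ∷ y′ ∷ []))
        (to (Sat-invariant φ (SamePattern-resp (∷∷-++-++ x y b missing) (∷∷-++-++ x′ y′ b missing) P))
          (proj₁ (φ-defines (x ∷ y ∷ [])) gxy))

    x₀ : M
    x₀ = proj₁ (far-point D w)

    x₀-far : Far D w x₀
    x₀-far = proj₂ (far-point D w)

    -- Otherwise g x₀ is R-far from x₀ as well, and any other point that far would have the same image.
    g-x₀-near-x₀ : Σ ℕ λ s → Σ ℕ λ t → s ≤ R × t ≤ R × f^ s (g x₀) ≡ f^ t x₀
    g-x₀-near-x₀ with lem (Σ ℕ λ s → Σ ℕ λ t → s ≤ R × t ≤ R × f^ s (g x₀) ≡ f^ t x₀)
    ... | yes near = near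
    ... | no y₀-far with far-point R (x₀ ∷ g x₀ ∷ w)
    ...   | x′ , x′-far = ⊥-elim (x′-far zero 0 0 z≤n z≤n (g-injective (graph⇒g (graph-invariant P (g-graph x₀)))))
      where
        P : SamePattern R (x₀ ∷ g x₀ ∷ w) (x′ ∷ g x₀ ∷ w)
        P = SamePattern-∷ x₀ x′ (SamePattern-refl (g x₀ ∷ w)) λ where
          zero    s t s≤R t≤R → ¬×¬⇒⇔ (λ e → y₀-far (t , s , t≤R , s≤R , sym e))
                                       (x′-far (suc zero) s t s≤R t≤R)
          (suc j) s t s≤R t≤R → ¬×¬⇒⇔ (x₀-far j s t (≤-trans s≤R (m≤m+n R R)) (≤-trans t≤R (m≤m+n R R)))
                                       (x′-far (suc (suc j)) s t s≤R t≤R)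

    -- x has the same D-pattern over w as x₀; extending it by g x₀ gives a partner of x, which must be g x.
    g-shifts-far-points : ∀ {s t} → s ≤ R → t ≤ R → f^ s (g x₀) ≡ f^ t x₀ →
      ∀ x → Far D w x → f^ s (g x) ≡ f^ t x
    g-shifts-far-points {s} {t} s≤R t≤R e x x-far =
      let (y , P) = extend-pattern R shares P₀ (g x₀) in
      trans (cong (f^ s) (graph⇒g (graph-invariant (SamePattern-swap P) (g-graph x₀))))
            (to (P zero (suc zero) s t s≤R t≤R) e)
      where
        P₀ : SamePattern D (x₀ ∷ w) (x ∷ w)
        P₀ = SamePattern-∷ x₀ x (SamePattern-refl w) λ j s t s≤D t≤D →
          ¬×¬⇒⇔ (x₀-far j s t s≤D t≤D) (x-far j s t s≤D t≤D)
        shares : SharesMissing (x₀ ∷ w) (x ∷ w)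
        shares l = suc (m ↑ʳ l) , lookup-++ʳ b missing l , lookup-++ʳ b missing l

    candidates : Fin (m + N) × ℕ × ℕ → List M
    candidates (j , s , t) = preimage s (f^ t (w j))

    near : List M
    near = concatMap candidates
             (cartesianProduct (allFin (m + N)) (cartesianProduct (upTo (suc D)) (upTo (suc D))))

    far-outside-near : ∀ x → x ∉ near → Far D w x
    far-outside-near x x∉near j s t s≤D t≤D e = x∉near (∈-concatMap⁺ candidates (lose
      (∈-cartesianProduct⁺ (∈-allFin j) (∈-cartesianProduct⁺ (∈-upTo⁺ (s≤s s≤D)) (∈-upTo⁺ (s≤s t≤D))))
      (∈-preimage e)))

    ∁Image-f^∘g : ∀ s → Enumerates (tabulate (shallow s) List.++ List.map (f^ s) (tabulate a)) (¬_ ∘ Image (f^ s ∘ g))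
    ∁Image-f^∘g s = ∁Image-∘ (f^ s) g (f^-inj s) (shallow-enumerates s) ∁Image-g

    defects-≡ : ∀ {s t} → s ≤ R → t ≤ R → f^ s (g x₀) ≡ f^ t x₀ → s * N + k ≡ t * N
    defects-≡ {s} {t} s≤R t≤R e = begin
      s * N + k
        ≡⟨ cong₂ _+_ (length-tabulate (shallow s)) (trans (length-map (f^ s) (tabulate a)) (length-tabulate a)) ⟨
      length (tabulate (shallow s)) + length (List.map (f^ s) (tabulate a))
        ≡⟨ length-++ (tabulate (shallow s)) ⟨
      length (tabulate (shallow s) List.++ List.map (f^ s) (tabulate a))
        ≡⟨ ∁Image-length-≡ (f^ s ∘ g) (f^ t) (g-injective ∘ f^-inj s) (f^-inj t) near agree
                            (∁Image-f^∘g s) (shallow-enumerates t) ⟩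
      length (tabulate (shallow t))
        ≡⟨ length-tabulate (shallow t) ⟩
      t * N
        ∎
      where
        open ≡-Reasoning
        agree : ∀ x → x ∉ near → f^ s (g x) ≡ f^ t x
        agree x x∉near = g-shifts-far-points s≤R t≤R e x (far-outside-near x x∉near)

    N∣k : N ∣ k
    N∣k = let (s , t , s≤R , t≤R , e) = g-x₀-near-x₀ in
      ∣m+n∣m⇒∣n (subst (N ∣_) (sym (defects-≡ s≤R t≤R e)) (n∣m*n t)) (n∣m*n s)

  _≟_ : DecidableEquality M
  x ≟ y = lem (x ≡ y)

  fresh-points : ∀ n {n′} (v : Vector M n′) →
    Σ (Vector M n) λ r → (∀ i j → r i ≡ r j → i ≡ j) × (∀ i j → r i ≢ v j)
  fresh-points n v with orbit-bound (missing i₀) v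
  ... | B , bound = (λ i → f^ (B + toℕ i) (missing i₀))
                  , (λ i j e → toℕ-injective (+-cancelˡ-≡ B _ _ (f^-aperiodic (missing i₀) e)))
                  , (λ i j e → m+n≮m B (toℕ i) (bound j (B + toℕ i) e))

  -- Two swaps through fresh points are needed because the shallow points may meet a.
  bijection-if-divisible : ∀ {k} (a : Vector M k) → (∀ i j → a i ≡ a j → i ≡ j) → N ∣ k →
    DefBijection 𝑀 (Whole 𝑀) (Deprived 𝑀 a)
  bijection-if-divisible a a-injective (divides q refl) with fresh-points (q * N) (shallow q ++ a)
  ... | r , r-injective , r-fresh =
    DefBijection-∘ (DefBijection-∘ onto-deep
      (swap-DefBijection _≟_ (shallow q) r (shallow-injective q) r-injective shallow∩r≡∅))
      (swap-DefBijection _≟_ r a r-injective a-injective r∩a≡∅)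
    where
      onto-deep : DefBijection 𝑀 (Whole 𝑀) (Deprived 𝑀 (shallow q))
      onto-deep = DefBijection-resp-codomain (Image⇔Deprived-shallow q) (f^-DefBijection f-injective q)
      shallow∩r≡∅ : ∀ i j → shallow q i ≢ r j
      shallow∩r≡∅ i j e = r-fresh j (i ↑ˡ _) (trans (sym e) (sym (lookup-++ˡ (shallow q) a i)))
      r∩a≡∅ : ∀ i j → r i ≢ a j
      r∩a≡∅ i j e = r-fresh i (q * N ↑ʳ j) (trans e (sym (lookup-++ʳ (shallow q) a j)))

  injection-into-deprived : ∀ x → DefInjection 𝑀 (Whole 𝑀) (Deprived 𝑀 (single x))
  injection-into-deprived x with lem (Image f x)
  ... | no x∉im = DefMap-mono-codomain x∉im⇒deprived (proj₁ (proj₁ (f^-DefBijection f-injective 1))) ,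
                  proj₂ (proj₁ (f^-DefBijection f-injective 1))
    where
      x∉im⇒deprived : ∀ {y} → Image (f^ 1) y → Deprived 𝑀 (single x) y
      x∉im⇒deprived (z , fz≡y) zero y≡x = x∉im (z , trans fz≡y y≡x)
  ... | yes (y₀ , fy₀≡x) = h , injective
    where
      Graph : M → M → Set
      Graph z w = ((z ≡ y₀) × (w ≡ missing i₀)) ⊎ ((z ≢ y₀) × (w ≡ f z))
      Z W Y₀ M₀ : Term 4
      Z  = var zero
      W  = var (suc zero)
      Y₀ = var (suc (suc zero))
      M₀ = var (suc (suc (suc zero)))
      h : DefMap 𝑀 (Whole 𝑀) (Deprived 𝑀 (single x))
      h = record
        { Graph      = Graph
        ; definable  = 2 , ((Z ≐ Y₀) ∧' (W ≐ M₀)) ∨' ((¬' (Z ≐ Y₀)) ∧' (W ≐ app Z))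
                         , (y₀ ∷ missing i₀ ∷ []) , λ _ → (λ g → g) , (λ g → g)
        ; graph⊆     = λ where
            (inj₁ (_ , w≡m₀))    → tt , λ { zero w≡x →
              missing-out i₀ y₀ (trans fy₀≡x (trans (sym w≡x) w≡m₀)) }
            (inj₂ (z≢y₀ , w≡fz)) → tt , λ { zero w≡x →
              z≢y₀ (f-injective (trans (sym w≡fz) (trans w≡x (sym fy₀≡x)))) }
        ; total      = λ {z} _ → case z ≟ y₀ of λ where
            (yes z≡y₀) → missing i₀ , inj₁ (z≡y₀ , refl)
            (no z≢y₀)  → f z , inj₂ (z≢y₀ , refl)
        ; functional = λ where
            (inj₁ (_ , w≡m₀)) (inj₁ (_ , w′≡m₀)) → trans w≡m₀ (sym w′≡m₀)
            (inj₁ (z≡y₀ , _)) (inj₂ (z≢y₀ , _))  → ⊥-elim (z≢y₀ z≡y₀)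
            (inj₂ (z≢y₀ , _)) (inj₁ (z≡y₀ , _))  → ⊥-elim (z≢y₀ z≡y₀)
            (inj₂ (_ , w≡fz)) (inj₂ (_ , w′≡fz)) → trans w≡fz (sym w′≡fz)
        }
      injective : ∀ {z z′ w} → Graph z w → Graph z′ w → z ≡ z′
      injective (inj₁ (z≡y₀ , _)) (inj₁ (z′≡y₀ , _)) = trans z≡y₀ (sym z′≡y₀)
      injective {z′ = z′} (inj₁ (_ , w≡m₀)) (inj₂ (_ , w≡fz′)) =
        ⊥-elim (missing-out i₀ z′ (trans (sym w≡fz′) w≡m₀))
      injective {z = z} (inj₂ (_ , w≡fz)) (inj₁ (_ , w≡m₀)) =
        ⊥-elim (missing-out i₀ z (trans (sym w≡fz) w≡m₀))
      injective (inj₂ (_ , w≡fz)) (inj₂ (_ , w≡fz′)) = f-injective (trans (sym w≡fz) w≡fz′)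

corollary1p5 : LEM → (N : ℕ) → .{{_ : NonZero N}} → (𝑀 : Structure) → IsModelT 𝑀 N →
    ((k : ℕ) → (a : Vector (Structure.Carrier 𝑀) k) → (∀ i j → a i ≡ a j → i ≡ j) →
      (DefBijection 𝑀 (Whole 𝑀) (Deprived 𝑀 a) → N ∣ k) ×
      (N ∣ k → DefBijection 𝑀 (Whole 𝑀) (Deprived 𝑀 a)))
    × (N ≥ 2 → (x : Structure.Carrier 𝑀) →
      DefInjection 𝑀 (Whole 𝑀) (Deprived 𝑀 (single x)) ×
      DefInjection 𝑀 (Deprived 𝑀 (single x)) (Whole 𝑀) ×
      ¬ DefBijection 𝑀 (Whole 𝑀) (Deprived 𝑀 (single x)))
corollary1p5 lem zero    𝑀 T = ⊥-elim (≢-nonZero⁻¹ zero refl)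
corollary1p5 lem (suc n) 𝑀 T =
  (λ k a a-injective → Necessity.N∣k a a-injective , bijection-if-divisible a a-injective) ,
  (λ N≥2 x → injection-into-deprived x , Definability.inclusion-deprived 𝑀 x ,
    λ bijection → <⇒≢ N≥2 (sym (∣1⇒≡1 (Necessity.N∣k (single x) single-injective bijection))))
  where
    open Model lem 𝑀 T zero
    single-injective : ∀ {x : Structure.Carrier 𝑀} (i j : Fin 1) → single x i ≡ single x j → i ≡ j
    single-injective zero zero _ = refl
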